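{- For a positive integer $n$ and a nonnegative integer $s$, the number of overpartitions of $n$ with exactly $s$ overlined parts equals the number of Schmidt $2$-overpartitions of $n$ with exactly $s$ overlined parts.
   Context: An overpartition is a partition (finite weakly decreasing sequence of positive integers) in which the final occurrence of each part value may be overlined. A strict overpartition is an overpartition $(\lambda_1,\ldots,\lambda_l)$ with $\lambda_1>\cdots>\lambda_l$ in which $\lambda_i$ may be overlined only if $\lambda_i-\lambda_{i+1}\geq 2$ or $\lambda_i=\lambda_l$. A Schmidt $2$-overpartition of $n$ is a strict overpartition $(\lambda_1,\lambda_2,\ldots)$ with $\lambda_1+\lambda_3+\lambda_5+\cdots=n$. -}

module Defs where

open import Data.Nat using (ℕ; zero; suc; _+_; _<ᵇ_; _≤ᵇ_; _≡ᵇ_)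
open import Data.Bool using (Bool; true; false; _∧_; _∨_; not; T; T?)
open import Data.List using (List; []; _∷_; map; length; filter)
open import Data.Nat.ListAction using (sum)
open import Relation.Binary.PropositionalEquality using (_≡_)
open import Data.Product using (_×_; _,_; proj₁; proj₂; Σ)

-- A part is a pair (value , overlined?).  A (candidate) overpartition is the
-- list of its parts λ₁, λ₂, … in order, each tagged with whether it is overlined.
Part : Set
Part = ℕ × Bool

isOverpartition : List Part → Bool
isOverpartition [] = true
isOverpartition ((a , o) ∷ []) = 0 <ᵇ a
isOverpartition ((a , o) ∷ (b , p) ∷ r) =
  (0 <ᵇ a) ∧ (b ≤ᵇ a) ∧ (not o ∨ not (a ≡ᵇ b)) ∧ isOverpartition ((b , p) ∷ r)

isStrictOverpartition : List Part → Bool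
isStrictOverpartition [] = true
isStrictOverpartition ((a , o) ∷ []) = 0 <ᵇ a
isStrictOverpartition ((a , o) ∷ (b , p) ∷ r) =
  (0 <ᵇ a) ∧ (b <ᵇ a) ∧ (not o ∨ (b + 2 ≤ᵇ a)) ∧ isStrictOverpartition ((b , p) ∷ r)

size : List Part → ℕ
size l = sum (map proj₁ l)

numOverlined : List Part → ℕ
numOverlined l = length (filter (λ x → T? (proj₂ x)) l)

oddIndexedSum : List Part → ℕ
oddIndexedSum [] = 0
oddIndexedSum (x ∷ []) = proj₁ x
oddIndexedSum (x ∷ y ∷ r) = proj₁ x + oddIndexedSum r

Overpartitions : ℕ → ℕ → Set
Overpartitions n s =
  Σ (List Part) λ l → T (isOverpartition l) × size l ≡ n × numOverlined l ≡ s

Schmidt2Overpartitions : ℕ → ℕ → Set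
Schmidt2Overpartitions n s =
  Σ (List Part) λ l → T (isStrictOverpartition l) × oddIndexedSum l ≡ n × numOverlined l ≡ s

-- Read a strict overpartition λ as the hook lengths of an overpartition μ: λ₁, λ₃, λ₅, …
-- are the hooks of the diagonal cells (k, k) of μ and λ₂, λ₄, … those of the cells (k+1, k)
-- just below them.  The diagonal hooks tile the diagram, so |μ| = λ₁ + λ₃ + ⋯.  Conversely μ
-- is rebuilt from λ by recursion: if ν comes from λ₃, λ₄, …, add to ν a first column of height
-- λ₂ − ν₁ and then a first row of length λ₁ − λ₂ + ν₁.  The overline of λ₁ goes to that row and
-- the overline of λ₂ to the bottom cell of that column; the condition λᵢ − λᵢ₊₁ ≥ 2 for an
-- overlined λᵢ is exactly what makes these cells final occurrences of their values.
module Submission where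

open import Defs
open import Data.Bool using (Bool; true; false; T; not; _∧_; _∨_; T?)
open import Data.Bool.Properties using (T-irrelevant)
open import Data.Empty using (⊥-elim)
open import Data.List using (List; []; _∷_; [_]; _++_; map; length; filter)
open import Data.List.Properties using (length-++; length-map; map-++; filter-++; ∷-injective; ∷-injectiveʳ)
open import Data.Nat using (ℕ; zero; suc; pred; _+_; _∸_; _≤_; _<_; z≤n; s≤s; _<ᵇ_; _≤ᵇ_; _≡ᵇ_)
open import Data.Nat.ListAction using (sum)
open import Data.Nat.ListAction.Properties using (sum-++)
open import Data.Nat.Properties
open import Data.Nat.Induction using (<-wellFounded)
open import Data.Product using (Σ; ∃; _×_; _,_; proj₁; proj₂; map₁)
open import Data.Product.Properties using (,-injective)
open import Function.Bundles using (_↔_; mk↔ₛ′)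
open import Induction.WellFounded using (Acc; acc)
open import Relation.Binary.PropositionalEquality hiding ([_])

largest : List Part → ℕ
largest [] = 0
largest ((a , _) ∷ _) = a

headSuc : List Part → ℕ
headSuc [] = 0
headSuc ((a , _) ∷ _) = suc a

data IsOverpartition : List Part → Set where
  []   : IsOverpartition []
  cons : ∀ {a o U} → 0 < a → largest U ≤ a → (T o → largest U < a) →
         IsOverpartition U → IsOverpartition ((a , o) ∷ U)

-- For r = [] the conditions only say 0 < a: the last part may always be overlined.
data IsStrictOverpartition : List Part → Set where
  []   : IsStrictOverpartition []
  cons : ∀ {a o r} → largest r < a → (T o → headSuc r < a) →
         IsStrictOverpartition r → IsStrictOverpartition ((a , o) ∷ r)

∧⁴-elim : ∀ {w x y z} → T (w ∧ x ∧ y ∧ z) → T w × T x × T y × T z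
∧⁴-elim {true}  {true}  {true}  h = _ , _ , _ , h
∧⁴-elim {true}  {true}  {false} ()
∧⁴-elim {true}  {false} ()
∧⁴-elim {false} ()

∧⁴-intro : ∀ {w x y z} → T w → T x → T y → T z → T (w ∧ x ∧ y ∧ z)
∧⁴-intro {true} {true} {true} _ _ _ h = h

implies-elim : ∀ {o x} → T (not o ∨ x) → T o → T x
implies-elim {true} x _ = x

implies-intro : ∀ {o x} → (T o → T x) → T (not o ∨ x)
implies-intro {false} _ = _
implies-intro {true}  h = h _

not≡ᵇ⇒≢ : ∀ a b → T (not (a ≡ᵇ b)) → a ≢ b
not≡ᵇ⇒≢ a b t a≡b with a ≡ᵇ b in eq
... | false = subst T eq (≡⇒≡ᵇ a b a≡b)

≢⇒not≡ᵇ : ∀ a b → a ≢ b → T (not (a ≡ᵇ b))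
≢⇒not≡ᵇ a b a≢b with a ≡ᵇ b in eq
... | true  = a≢b (≡ᵇ⇒≡ a b (subst T (sym eq) _))
... | false = _

isOverpartition⇒IsOverpartition : ∀ l → T (isOverpartition l) → IsOverpartition l
isOverpartition⇒IsOverpartition [] _ = []
isOverpartition⇒IsOverpartition ((a , o) ∷ []) t =
  cons (<ᵇ⇒< 0 a t) z≤n (λ _ → <ᵇ⇒< 0 a t) []
isOverpartition⇒IsOverpartition ((a , o) ∷ (b , p) ∷ r) t =
  let pos , b≤a , distinct , rest = ∧⁴-elim {0 <ᵇ a} {b ≤ᵇ a} t in
  cons (<ᵇ⇒< 0 a pos) (≤ᵇ⇒≤ b a b≤a)
      (λ t → ≤∧≢⇒< (≤ᵇ⇒≤ b a b≤a) (≢-sym (not≡ᵇ⇒≢ a b (implies-elim distinct t))))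
      (isOverpartition⇒IsOverpartition _ rest)

IsOverpartition⇒isOverpartition : ∀ {l} → IsOverpartition l → T (isOverpartition l)
IsOverpartition⇒isOverpartition [] = _
IsOverpartition⇒isOverpartition (cons pos _ _ []) = <⇒<ᵇ pos
IsOverpartition⇒isOverpartition (cons {a} {o} {(b , p) ∷ r} pos b≤a b<a rest) =
  ∧⁴-intro {0 <ᵇ a} {b ≤ᵇ a} (<⇒<ᵇ pos) (≤⇒≤ᵇ b≤a)
    (implies-intro (λ t → ≢⇒not≡ᵇ a b (>⇒≢ (b<a t))))
    (IsOverpartition⇒isOverpartition rest)

isStrict⇒IsStrict : ∀ l → T (isStrictOverpartition l) → IsStrictOverpartition l
isStrict⇒IsStrict [] _ = []
isStrict⇒IsStrict ((a , o) ∷ []) t = cons (<ᵇ⇒< 0 a t) (λ _ → <ᵇ⇒< 0 a t) []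
isStrict⇒IsStrict ((a , o) ∷ (b , p) ∷ r) t =
  let _ , b<a , gap , rest = ∧⁴-elim {0 <ᵇ a} {b <ᵇ a} t in
  cons (<ᵇ⇒< b a b<a)
      (λ t → subst (_≤ a) (+-comm b 2) (≤ᵇ⇒≤ (b + 2) a (implies-elim gap t)))
      (isStrict⇒IsStrict _ rest)

IsStrict⇒isStrict : ∀ {l} → IsStrictOverpartition l → T (isStrictOverpartition l)
IsStrict⇒isStrict [] = _
IsStrict⇒isStrict (cons pos _ []) = <⇒<ᵇ pos
IsStrict⇒isStrict (cons {a} {o} {(b , p) ∷ r} b<a gap rest) =
  ∧⁴-intro {0 <ᵇ a} {b <ᵇ a} (<⇒<ᵇ (≤-trans (s≤s z≤n) b<a)) (<⇒<ᵇ b<a)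
    (implies-intro (λ t → ≤⇒≤ᵇ (subst (_≤ a) (+-comm 2 b) (gap t))))
    (IsStrict⇒isStrict rest)

bit : Bool → ℕ
bit true  = 1
bit false = 0

numOverlined-∷ : ∀ a o l → numOverlined ((a , o) ∷ l) ≡ bit o + numOverlined l
numOverlined-∷ a true  l = refl
numOverlined-∷ a false l = refl

numOverlined-++ : ∀ l l′ → numOverlined (l ++ l′) ≡ numOverlined l + numOverlined l′
numOverlined-++ l l′ =
  trans (cong length (filter-++ (λ x → T? (proj₂ x)) l l′)) (length-++ (filter (λ x → T? (proj₂ x)) l))

size-++ : ∀ l l′ → size (l ++ l′) ≡ size l + size l′
size-++ l l′ = trans (cong sum (map-++ proj₁ l l′)) (sum-++ (map proj₁ l) (map proj₁ l′))

raise : List Part → List Part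
raise = map (map₁ suc)

size-raise : ∀ ν → size (raise ν) ≡ size ν + length ν
size-raise [] = refl
size-raise ((a , _) ∷ ν) = begin
  suc a + size (raise ν)        ≡⟨ cong (suc a +_) (size-raise ν) ⟩
  suc a + (size ν + length ν)   ≡⟨ cong suc (+-assoc a (size ν) (length ν)) ⟨
  suc (a + size ν + length ν)   ≡⟨ +-suc (a + size ν) (length ν) ⟨
  a + size ν + suc (length ν)   ∎
  where open ≡-Reasoning

numOverlined-raise : ∀ ν → numOverlined (raise ν) ≡ numOverlined ν
numOverlined-raise [] = refl
numOverlined-raise ((a , o) ∷ ν) = begin
  numOverlined ((suc a , o) ∷ raise ν) ≡⟨ numOverlined-∷ (suc a) o (raise ν) ⟩
  bit o + numOverlined (raise ν)       ≡⟨ cong (bit o +_) (numOverlined-raise ν) ⟩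
  bit o + numOverlined ν               ≡⟨ numOverlined-∷ a o ν ⟨
  numOverlined ((a , o) ∷ ν)           ∎
  where open ≡-Reasoning

ones : ℕ → Bool → List Part
ones 0 f = []
ones 1 f = [ (1 , f) ]
ones (suc (suc c)) f = (1 , false) ∷ ones (suc c) f

length-ones : ∀ c f → length (ones c f) ≡ c
length-ones 0 f = refl
length-ones 1 f = refl
length-ones (suc (suc c)) f = cong suc (length-ones (suc c) f)

size-ones : ∀ c f → size (ones c f) ≡ c
size-ones 0 f = refl
size-ones 1 f = refl
size-ones (suc (suc c)) f = cong suc (size-ones (suc c) f)

numOverlined-ones : ∀ c f → (T f → 0 < c) → numOverlined (ones c f) ≡ bit f
numOverlined-ones 0 false _ = refl
numOverlined-ones 0 true  h with () ← h _
numOverlined-ones 1 f _ = trans (numOverlined-∷ 1 f []) (+-identityʳ (bit f))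
numOverlined-ones (suc (suc c)) f _ = numOverlined-ones (suc c) f (λ _ → s≤s z≤n)

largest-ones : ∀ c f → largest (ones (suc c) f) ≡ 1
largest-ones 0 f = refl
largest-ones (suc c) f = refl

ones-over : ∀ c f → IsOverpartition (ones c f)
ones-over 0 f = []
ones-over 1 f = cons (s≤s z≤n) z≤n (λ _ → s≤s z≤n) []
ones-over (suc (suc c)) f =
  cons (s≤s z≤n) (≤-reflexive (largest-ones c f)) (λ ()) (ones-over (suc c) f)

ones-injectiveʳ : ∀ c {f f′} → (T f → 0 < c) → (T f′ → 0 < c) → ones c f ≡ ones c f′ → f ≡ f′
ones-injectiveʳ 0 {false} {false} _ _ _ = refl
ones-injectiveʳ 0 {true} h _ _ with () ← h _
ones-injectiveʳ 0 {false} {true} _ h _ with () ← h _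
ones-injectiveʳ 1 _ _ refl = refl
ones-injectiveʳ (suc (suc c)) _ _ e =
  ones-injectiveʳ (suc c) (λ _ → s≤s z≤n) (λ _ → s≤s z≤n) (∷-injectiveʳ e)

-- Adds a first column of height h to the diagram of ν, overlining its bottom cell iff f;
-- it is a genuine column only under `Fits ν h f` (h ∸ length ν truncates).
addColumn : List Part → ℕ → Bool → List Part
addColumn ν h f = raise ν ++ ones (h ∸ length ν) f

Fits : List Part → ℕ → Bool → Set
Fits ν h f = length ν ≤ h × (T f → length ν < h)

length-addColumn : ∀ ν {h} f → length ν ≤ h → length (addColumn ν h f) ≡ h
length-addColumn ν {h} f ν≤h = begin
  length (raise ν ++ ones (h ∸ length ν) f)           ≡⟨ length-++ (raise ν) ⟩
  length (raise ν) + length (ones (h ∸ length ν) f)   ≡⟨ cong₂ _+_ (length-map _ ν) (length-ones _ f) ⟩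
  length ν + (h ∸ length ν)                           ≡⟨ m+[n∸m]≡n ν≤h ⟩
  h                                                   ∎
  where open ≡-Reasoning

size-addColumn : ∀ ν {h} f → length ν ≤ h → size (addColumn ν h f) ≡ size ν + h
size-addColumn ν {h} f ν≤h = begin
  size (raise ν ++ ones (h ∸ length ν) f)         ≡⟨ size-++ (raise ν) _ ⟩
  size (raise ν) + size (ones (h ∸ length ν) f)   ≡⟨ cong₂ _+_ (size-raise ν) (size-ones _ f) ⟩
  size ν + length ν + (h ∸ length ν)              ≡⟨ +-assoc (size ν) _ _ ⟩
  size ν + (length ν + (h ∸ length ν))            ≡⟨ cong (size ν +_) (m+[n∸m]≡n ν≤h) ⟩
  size ν + h                                      ∎
  where open ≡-Reasoning

numOverlined-addColumn : ∀ ν {h} f → Fits ν h f →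
                         numOverlined (addColumn ν h f) ≡ numOverlined ν + bit f
numOverlined-addColumn ν {h} f (_ , ν<h) = begin
  numOverlined (raise ν ++ ones (h ∸ length ν) f)
    ≡⟨ numOverlined-++ (raise ν) _ ⟩
  numOverlined (raise ν) + numOverlined (ones (h ∸ length ν) f)
    ≡⟨ cong₂ _+_ (numOverlined-raise ν) (numOverlined-ones _ f (λ t → m<n⇒0<n∸m (ν<h t))) ⟩
  numOverlined ν + bit f
    ∎
  where open ≡-Reasoning

largest-addColumn : ∀ ν {h} f → 0 < h → largest (addColumn ν h f) ≡ suc (largest ν)
largest-addColumn [] {suc h} f _ = largest-ones h f
largest-addColumn (_ ∷ _) f _ = refl

largest≤pred-largest-addColumn : ∀ ν h f → largest ν ≤ pred (largest (addColumn ν h f))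
largest≤pred-largest-addColumn [] h f = z≤n
largest≤pred-largest-addColumn (_ ∷ _) h f = ≤-refl

raise-++-over : ∀ {ν W} → IsOverpartition ν → IsOverpartition W → largest W ≤ 1 →
                IsOverpartition (raise ν ++ W)
raise-++-over [] W-over _ = W-over
raise-++-over (cons {U = []} pos _ _ []) W-over W≤1 =
  cons (s≤s z≤n) (≤-trans W≤1 (s≤s z≤n)) (λ _ → s≤s (≤-trans W≤1 pos)) W-over
raise-++-over (cons {U = _ ∷ _} _ ν≤a ν<a rest) W-over W≤1 =
  cons (s≤s z≤n) (s≤s ν≤a) (λ t → s≤s (ν<a t)) (raise-++-over rest W-over W≤1)

addColumn-over : ∀ {ν} h f → IsOverpartition ν → IsOverpartition (addColumn ν h f)
addColumn-over {ν} h f ν-over = raise-++-over ν-over (ones-over _ f) (largest-ones≤1 (h ∸ length ν))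
  where
  largest-ones≤1 : ∀ c → largest (ones c f) ≤ 1
  largest-ones≤1 zero    = z≤n
  largest-ones≤1 (suc c) = ≤-reflexive (largest-ones c f)

raise-++-ones-injective : ∀ {ν ν′ c c′ f f′} → IsOverpartition ν → IsOverpartition ν′ →
                          raise ν ++ ones c f ≡ raise ν′ ++ ones c′ f′ → ν ≡ ν′ × ones c f ≡ ones c′ f′
raise-++-ones-injective [] [] e = refl , e
raise-++-ones-injective {c = zero} [] (cons _ _ _ _) ()
raise-++-ones-injective {c = suc c} {f = f} [] (cons pos _ _ _) e
  with refl ← trans (sym (largest-ones c f)) (cong largest e) = ⊥-elim (<-irrefl refl pos)
raise-++-ones-injective {c′ = zero} (cons _ _ _ _) [] ()
raise-++-ones-injective {c′ = suc c′} {f′ = f′} (cons pos _ _ _) [] e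
  with refl ← trans (sym (largest-ones c′ f′)) (cong largest (sym e)) = ⊥-elim (<-irrefl refl pos)
raise-++-ones-injective (cons _ _ _ rest) (cons _ _ _ rest′) e
  with e-head , e-tail ← ∷-injective e
  with ν≡ν′ , ones≡ ← raise-++-ones-injective rest rest′ e-tail
  with refl ← e-head = cong (_ ∷_) ν≡ν′ , ones≡

addColumn-injective : ∀ {ν ν′ h h′ f f′} → IsOverpartition ν → IsOverpartition ν′ →
                      Fits ν h f → Fits ν′ h′ f′ → addColumn ν h f ≡ addColumn ν′ h′ f′ →
                      ν ≡ ν′ × h ≡ h′ × f ≡ f′
addColumn-injective {ν} {ν′} {f = f} {f′ = f′} ν-over ν′-over (ν≤h , ν<h) (ν′≤h′ , ν′<h′) e
  with refl , ones≡ ← raise-++-ones-injective ν-over ν′-over e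
  with refl ← trans (sym (length-addColumn ν f ν≤h)) (trans (cong length e) (length-addColumn ν′ f′ ν′≤h′))
  = refl , refl , ones-injectiveʳ _ (λ t → m<n⇒0<n∸m (ν<h t)) (λ t → m<n⇒0<n∸m (ν′<h′ t)) ones≡

record FirstColumn (U : List Part) : Set where
  constructor firstColumn
  field
    rest      : List Part
    bottom    : Bool
    rest-over : IsOverpartition rest
    fits      : Fits rest (length U) bottom
    shape     : U ≡ addColumn rest (length U) bottom

ones-shape : ∀ {p U} → IsOverpartition ((1 , p) ∷ U) → ∃ λ f → (1 , p) ∷ U ≡ ones (suc (length U)) f
ones-shape {p} {[]} _ = p , refl
ones-shape {U = (0 , _) ∷ _} (cons _ _ _ (cons () _ _ _))
ones-shape {U = (suc (suc _) , _) ∷ _} (cons _ (s≤s ()) _ _)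
ones-shape {true} {(1 , _) ∷ _} (cons _ _ 1<1 _) with s≤s () ← 1<1 _
ones-shape {false} {(1 , _) ∷ _} (cons _ _ _ rest) with f , eq ← ones-shape rest =
  f , cong ((1 , false) ∷_) eq

splitFirstColumn : ∀ {U} → IsOverpartition U → FirstColumn U
splitFirstColumn [] = firstColumn [] false [] (z≤n , λ ()) refl
splitFirstColumn (cons {0} () _ _ _)
splitFirstColumn U-over@(cons {1} _ _ _ _) with f , eq ← ones-shape U-over =
  firstColumn [] f [] (z≤n , λ _ → s≤s z≤n) eq
splitFirstColumn (cons {suc (suc b)} {p} {U} _ U≤a U<a U-over)
  with firstColumn ν f ν-over (ν≤U , ν<U) eq ← splitFirstColumn U-over =
  firstColumn ((suc b , p) ∷ ν) f (cons (s≤s z≤n) ν≤b+1 (λ t → s≤s (ν≤b t)) ν-over)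
    (s≤s ν≤U , λ t → s≤s (ν<U t)) (cong ((suc (suc b) , p) ∷_) eq)
  where
  ν≤predU : largest ν ≤ pred (largest U)
  ν≤predU = subst (λ V → largest ν ≤ pred (largest V)) (sym eq)
                  (largest≤pred-largest-addColumn ν (length U) f)
  ν≤b+1 : largest ν ≤ suc b
  ν≤b+1 = ≤-trans ν≤predU (pred-mono-≤ U≤a)
  ν≤b : T p → largest ν ≤ b
  ν≤b t = ≤-trans ν≤predU (pred-mono-≤ (≤-pred (U<a t)))

row : ℕ → ℕ → List Part → ℕ
row x₁ x₂ ν = x₁ ∸ x₂ + largest ν

column : ℕ → List Part → ℕ
column x₂ ν = x₂ ∸ largest ν

hookPartition : List Part → List Part
hookPartition [] = []
hookPartition (p ∷ []) = p ∷ []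
hookPartition ((x₁ , o) ∷ (x₂ , f) ∷ r) =
  (row x₁ x₂ (hookPartition r) , o) ∷ addColumn (hookPartition r) (column x₂ (hookPartition r)) f

record Corner (x₁ : ℕ) (o : Bool) (x₂ : ℕ) (f : Bool) (ν : List Part) : Set where
  field
    row+column≡x₁     : row x₁ x₂ ν + column x₂ ν ≡ x₁
    largest+column≡x₂ : largest ν + column x₂ ν ≡ x₂
    column-pos        : 0 < column x₂ ν
    column-fits       : Fits ν (column x₂ ν) f
    largest<row       : suc (largest ν) ≤ row x₁ x₂ ν
    overline-gap      : T o → suc (suc (largest ν)) ≤ row x₁ x₂ ν

headSuc≤⇒largest< : ∀ {x} r → 0 < x → headSuc r ≤ x → largest r < x
headSuc≤⇒largest< [] pos _ = pos
headSuc≤⇒largest< (_ ∷ _) _ r≤x = r≤x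

largest<⇒headSuc≤ : ∀ {x} r → largest r < x → headSuc r ≤ x
largest<⇒headSuc≤ [] _ = z≤n
largest<⇒headSuc≤ (_ ∷ _) r<x = r<x

headSuc≤largest+length : ∀ ν → headSuc ν ≤ largest ν + length ν
headSuc≤largest+length [] = z≤n
headSuc≤largest+length ((a , _) ∷ _) = m<m+n a (s≤s z≤n)

corner : ∀ {x₁ o x₂ f r} ν → IsStrictOverpartition ((x₁ , o) ∷ (x₂ , f) ∷ r) →
         largest ν + length ν ≡ headSuc r → Corner x₁ o x₂ f ν
corner {x₁} {o} {x₂} {f} {r} ν (cons x₂<x₁ gap₁ (cons r<x₂ gap₂ _)) hook≡ = record
  { row+column≡x₁     = begin
      x₁ ∸ x₂ + L + (x₂ ∸ L)     ≡⟨ +-assoc (x₁ ∸ x₂) L _ ⟩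
      x₁ ∸ x₂ + (L + (x₂ ∸ L))   ≡⟨ cong (x₁ ∸ x₂ +_) (m+[n∸m]≡n L≤x₂) ⟩
      x₁ ∸ x₂ + x₂               ≡⟨ m∸n+n≡m (<⇒≤ x₂<x₁) ⟩
      x₁                         ∎
  ; largest+column≡x₂ = m+[n∸m]≡n L≤x₂
  ; column-pos        = m<n⇒0<n∸m L<x₂
  ; column-fits       = column-above hook≤x₂
                      , λ t → column-above (subst (_≤ x₂) (sym (+-suc L (length ν))) (hook<x₂ t))
  ; largest<row       = +-monoˡ-≤ L (m<n⇒0<n∸m x₂<x₁)
  ; overline-gap      = λ t → +-monoˡ-≤ L (m+n≤o⇒m≤o∸n 2 (gap₁ t))
  }
  where
  open ≡-Reasoning
  L = largest ν
  hook≤x₂ : L + length ν ≤ x₂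
  hook≤x₂ = subst (_≤ x₂) (sym hook≡) (largest<⇒headSuc≤ r r<x₂)
  hook<x₂ : T f → L + length ν < x₂
  hook<x₂ t = subst (_< x₂) (sym hook≡) (gap₂ t)
  column-above : ∀ {k} → L + k ≤ x₂ → k ≤ x₂ ∸ L
  column-above {k} le = subst (_≤ x₂ ∸ L) (m+n∸m≡n L k) (∸-monoˡ-≤ L le)
  L<x₂ : L < x₂
  L<x₂ = headSuc≤⇒largest< ν (≤-trans (s≤s z≤n) r<x₂) (≤-trans (headSuc≤largest+length ν) hook≤x₂)
  L≤x₂ : L ≤ x₂
  L≤x₂ = <⇒≤ L<x₂

-- The corner cell of hookPartition ((x , q) ∷ r) has hook length x.
mutual
  largest+length-hookPartition : ∀ {l} → IsStrictOverpartition l →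
                                 largest (hookPartition l) + length (hookPartition l) ≡ headSuc l
  largest+length-hookPartition [] = refl
  largest+length-hookPartition (cons {a} _ _ []) = +-comm a 1
  largest+length-hookPartition l-strict@(cons {x₁} {o} {(x₂ , f) ∷ r} _ _ (cons _ _ _)) = begin
    row x₁ x₂ ν + suc (length (addColumn ν (column x₂ ν) f))
      ≡⟨ cong (λ k → row x₁ x₂ ν + suc k) (length-addColumn ν f (proj₁ column-fits)) ⟩
    row x₁ x₂ ν + suc (column x₂ ν)   ≡⟨ +-suc (row x₁ x₂ ν) (column x₂ ν) ⟩
    suc (row x₁ x₂ ν + column x₂ ν)   ≡⟨ cong suc row+column≡x₁ ⟩
    suc x₁                            ∎
    where
    ν = hookPartition r
    open Corner (hookPartition-corner l-strict)
    open ≡-Reasoning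

  hookPartition-corner : ∀ {x₁ o x₂ f r} → IsStrictOverpartition ((x₁ , o) ∷ (x₂ , f) ∷ r) →
                         Corner x₁ o x₂ f (hookPartition r)
  hookPartition-corner l-strict@(cons _ _ (cons _ _ r-strict)) =
    corner _ l-strict (largest+length-hookPartition r-strict)

hookPartition-over : ∀ {l} → IsStrictOverpartition l → IsOverpartition (hookPartition l)
hookPartition-over [] = []
hookPartition-over (cons pos _ []) = cons pos z≤n (λ _ → pos) []
hookPartition-over l-strict@(cons {x₁} {o} {(x₂ , f) ∷ r} _ _ (cons _ _ r-strict)) =
  cons (≤-trans (s≤s z≤n) largest<row)
       (subst (_≤ row x₁ x₂ ν) (sym largest≡) largest<row)
       (λ t → subst (_< row x₁ x₂ ν) (sym largest≡) (overline-gap t))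
       (addColumn-over _ f (hookPartition-over r-strict))
  where
  ν = hookPartition r
  open Corner (hookPartition-corner l-strict)
  largest≡ : largest (addColumn ν (column x₂ ν) f) ≡ suc (largest ν)
  largest≡ = largest-addColumn ν f column-pos

size-hookPartition : ∀ {l} → IsStrictOverpartition l → size (hookPartition l) ≡ oddIndexedSum l
size-hookPartition [] = refl
size-hookPartition (cons {a} _ _ []) = +-identityʳ a
size-hookPartition l-strict@(cons {x₁} {o} {(x₂ , f) ∷ r} _ _ (cons _ _ r-strict)) = begin
  row₁ + size (addColumn ν column₁ f) ≡⟨ cong (row₁ +_) (size-addColumn ν f (proj₁ column-fits)) ⟩
  row₁ + (size ν + column₁)           ≡⟨ cong (row₁ +_) (+-comm (size ν) column₁) ⟩
  row₁ + (column₁ + size ν)           ≡⟨ +-assoc row₁ column₁ (size ν) ⟨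
  row₁ + column₁ + size ν             ≡⟨ cong₂ _+_ row+column≡x₁ (size-hookPartition r-strict) ⟩
  x₁ + oddIndexedSum r                ∎
  where
  ν = hookPartition r
  row₁ = row x₁ x₂ ν
  column₁ = column x₂ ν
  open Corner (hookPartition-corner l-strict)
  open ≡-Reasoning

numOverlined-hookPartition : ∀ {l} → IsStrictOverpartition l →
                             numOverlined (hookPartition l) ≡ numOverlined l
numOverlined-hookPartition [] = refl
numOverlined-hookPartition (cons _ _ []) = refl
numOverlined-hookPartition l-strict@(cons {x₁} {o} {(x₂ , f) ∷ r} _ _ (cons _ _ r-strict)) = begin
  numOverlined ((row x₁ x₂ ν , o) ∷ addColumn ν (column x₂ ν) f)
    ≡⟨ numOverlined-∷ _ o _ ⟩
  bit o + numOverlined (addColumn ν (column x₂ ν) f)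
    ≡⟨ cong (bit o +_) (numOverlined-addColumn ν f column-fits) ⟩
  bit o + (numOverlined ν + bit f)
    ≡⟨ cong (λ k → bit o + (k + bit f)) (numOverlined-hookPartition r-strict) ⟩
  bit o + (numOverlined r + bit f)
    ≡⟨ cong (bit o +_) (+-comm (numOverlined r) (bit f)) ⟩
  bit o + (bit f + numOverlined r)
    ≡⟨ cong (bit o +_) (numOverlined-∷ x₂ f r) ⟨
  bit o + numOverlined ((x₂ , f) ∷ r)
    ≡⟨ numOverlined-∷ x₁ o _ ⟨
  numOverlined ((x₁ , o) ∷ (x₂ , f) ∷ r)
    ∎
  where
  ν = hookPartition r
  open Corner (hookPartition-corner l-strict)
  open ≡-Reasoning

corner-injective : ∀ {x₁ o x₂ f x₁′ o′ x₂′ f′ ν} → Corner x₁ o x₂ f ν → Corner x₁′ o′ x₂′ f′ ν →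
                   row x₁ x₂ ν ≡ row x₁′ x₂′ ν → column x₂ ν ≡ column x₂′ ν → x₁ ≡ x₁′ × x₂ ≡ x₂′
corner-injective {ν = ν} C C′ row≡ column≡ =
  trans (sym (Corner.row+column≡x₁ C)) (trans (cong₂ _+_ row≡ column≡) (Corner.row+column≡x₁ C′)) ,
  trans (sym (Corner.largest+column≡x₂ C))
        (trans (cong (largest ν +_) column≡) (Corner.largest+column≡x₂ C′))

column-nonempty : ∀ {x₁ o x₂ f r} → IsStrictOverpartition ((x₁ , o) ∷ (x₂ , f) ∷ r) →
                  [] ≢ addColumn (hookPartition r) (column x₂ (hookPartition r)) f
column-nonempty {f = f} {r} l-strict e = <-irrefl
  (trans (cong length e) (length-addColumn (hookPartition r) f (proj₁ column-fits))) column-pos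
  where open Corner (hookPartition-corner l-strict)

hookPartition-injective : ∀ {l l′} → IsStrictOverpartition l → IsStrictOverpartition l′ →
                          hookPartition l ≡ hookPartition l′ → l ≡ l′
hookPartition-injective [] [] _ = refl
hookPartition-injective [] (cons _ _ []) ()
hookPartition-injective [] (cons _ _ (cons _ _ _)) ()
hookPartition-injective (cons _ _ []) [] ()
hookPartition-injective (cons _ _ (cons _ _ _)) [] ()
hookPartition-injective (cons _ _ []) (cons _ _ []) refl = refl
hookPartition-injective (cons _ _ []) l′-strict@(cons _ _ (cons _ _ _)) e =
  ⊥-elim (column-nonempty l′-strict (∷-injectiveʳ e))
hookPartition-injective l-strict@(cons _ _ (cons _ _ _)) (cons _ _ []) e =
  ⊥-elim (column-nonempty l-strict (sym (∷-injectiveʳ e)))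
hookPartition-injective l-strict@(cons _ _ (cons _ _ r-strict)) l′-strict@(cons _ _ (cons _ _ r′-strict)) e
  with head≡ , tail≡ ← ∷-injective e
  with row≡ , refl ← ,-injective head≡
  with ν≡ , column≡ , refl ← addColumn-injective (hookPartition-over r-strict) (hookPartition-over r′-strict)
                               (Corner.column-fits (hookPartition-corner l-strict))
                               (Corner.column-fits (hookPartition-corner l′-strict)) tail≡
  with refl ← hookPartition-injective r-strict r′-strict ν≡
  with refl , refl ← corner-injective (hookPartition-corner l-strict) (hookPartition-corner l′-strict) row≡ column≡
  = refl

strict-∷ : ∀ {r ν h f} → IsStrictOverpartition r → largest ν + length ν ≡ headSuc r →
           0 < h → Fits ν h f → IsStrictOverpartition ((largest ν + h , f) ∷ r)
strict-∷ {r} {ν} {h} r-strict hook≡ h>0 (ν≤h , ν<h) =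
  cons (headSuc≤⇒largest< r (≤-trans h>0 (m≤n+m h L)) (subst (_≤ L + h) hook≡ (+-monoʳ-≤ L ν≤h)))
       (λ t → subst (_≤ L + h) (trans (+-suc L (length ν)) (cong suc hook≡)) (+-monoʳ-≤ L (ν<h t)))
       r-strict
  where L = largest ν

hookPartition-∷∷ : ∀ {a o h f r} → largest (hookPartition r) ≤ a →
                   hookPartition ((a + h , o) ∷ (largest (hookPartition r) + h , f) ∷ r) ≡
                   (a , o) ∷ addColumn (hookPartition r) h f
hookPartition-∷∷ {a} {o} {h} {f} {r} L≤a =
  cong₂ (λ x y → (x , o) ∷ addColumn ν y f) row≡a (m+n∸m≡n L h)
  where
  ν = hookPartition r
  L = largest ν
  row≡a : (a + h) ∸ (L + h) + L ≡ a
  row≡a = begin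
    (a + h) ∸ (L + h) + L   ≡⟨ cong₂ (λ x y → x ∸ y + L) (+-comm a h) (+-comm L h) ⟩
    (h + a) ∸ (h + L) + L   ≡⟨ cong (_+ L) ([m+n]∸[m+o]≡n∸o h a L) ⟩
    a ∸ L + L               ≡⟨ m∸n+n≡m L≤a ⟩
    a                       ∎
    where open ≡-Reasoning

hookPartition-extend : ∀ {a o U f r} → 0 < length U → largest U ≤ a → (T o → largest U < a) →
                       IsStrictOverpartition r → Fits (hookPartition r) (length U) f →
                       U ≡ addColumn (hookPartition r) (length U) f →
                       ∃ λ l → IsStrictOverpartition l × hookPartition l ≡ (a , o) ∷ U
hookPartition-extend {a} {o} {U} {f} {r} U>0 U≤a U<a r-strict fits shape =
  (a + h , o) ∷ (L + h , f) ∷ r ,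
  cons (+-monoˡ-< h L<a) (λ t → +-monoˡ-≤ h (gap t))
       (strict-∷ {ν = hookPartition r} r-strict (largest+length-hookPartition r-strict) U>0 fits) ,
  trans (hookPartition-∷∷ {h = h} {f} {r} (<⇒≤ L<a)) (cong ((a , o) ∷_) (sym shape))
  where
  h = length U
  L = largest (hookPartition r)
  largest≡ : largest U ≡ suc L
  largest≡ = trans (cong largest shape) (largest-addColumn (hookPartition r) f U>0)
  L<a : L < a
  L<a = subst (_≤ a) largest≡ U≤a
  gap : T o → suc (suc L) ≤ a
  gap t = subst (_< a) largest≡ (U<a t)

hookPartition-surjective : ∀ {μ} → IsOverpartition μ →
                           ∃ λ l → IsStrictOverpartition l × hookPartition l ≡ μ
hookPartition-surjective {μ} μ-over = go μ-over (<-wellFounded (length μ))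
  where
  go : ∀ {μ} → IsOverpartition μ → Acc _<_ (length μ) →
       ∃ λ l → IsStrictOverpartition l × hookPartition l ≡ μ
  go [] _ = [] , [] , refl
  go (cons {a} {o} pos _ _ []) _ = [ (a , o) ] , cons pos (λ _ → pos) [] , refl
  go (cons {U = _ ∷ _} _ U≤a U<a U-over) (acc rec)
    with firstColumn ν f ν-over fits shape ← splitFirstColumn U-over
    with r , r-strict , refl ← go ν-over (rec (s≤s (proj₁ fits)))
    = hookPartition-extend (s≤s z≤n) U≤a U<a r-strict fits shape

≡-from-proj₁ : ∀ {b : List Part → Bool} {m k : List Part → ℕ} {n s}
              {x y : Σ (List Part) λ l → T (b l) × m l ≡ n × k l ≡ s} → proj₁ x ≡ proj₁ y → x ≡ y
≡-from-proj₁ {x = l , t , p , q} {y = .l , t′ , p′ , q′} refl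
  with refl ← T-irrelevant t t′ | refl ← ≡-irrelevant p p′ | refl ← ≡-irrelevant q q′ = refl

overpartitions↔schmidt2 : ∀ n s → Overpartitions n s ↔ Schmidt2Overpartitions n s
overpartitions↔schmidt2 n s = mk↔ₛ′ toSchmidt fromSchmidt toSchmidt∘fromSchmidt fromSchmidt∘toSchmidt
  where
  preimage : ∀ μ → T (isOverpartition μ) → ∃ λ l → IsStrictOverpartition l × hookPartition l ≡ μ
  preimage μ t = hookPartition-surjective (isOverpartition⇒IsOverpartition μ t)

  toSchmidt : Overpartitions n s → Schmidt2Overpartitions n s
  toSchmidt (μ , t , size≡n , count≡s) =
    let l , l-strict , eq = preimage μ t in
    l , IsStrict⇒isStrict l-strict ,
    trans (sym (size-hookPartition l-strict)) (trans (cong size eq) size≡n) ,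
    trans (sym (numOverlined-hookPartition l-strict)) (trans (cong numOverlined eq) count≡s)

  fromSchmidt : Schmidt2Overpartitions n s → Overpartitions n s
  fromSchmidt (l , t , sum≡n , count≡s) =
    let l-strict = isStrict⇒IsStrict l t in
    hookPartition l , IsOverpartition⇒isOverpartition (hookPartition-over l-strict) ,
    trans (size-hookPartition l-strict) sum≡n , trans (numOverlined-hookPartition l-strict) count≡s

  toSchmidt∘fromSchmidt : ∀ y → toSchmidt (fromSchmidt y) ≡ y
  toSchmidt∘fromSchmidt (l , t , _) =
    let l-strict = isStrict⇒IsStrict l t
        _ , l′-strict , eq = preimage (hookPartition l) (IsOverpartition⇒isOverpartition (hookPartition-over l-strict))
    in ≡-from-proj₁ (hookPartition-injective l′-strict l-strict eq)

  fromSchmidt∘toSchmidt : ∀ x → fromSchmidt (toSchmidt x) ≡ x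
  fromSchmidt∘toSchmidt (μ , t , _) = ≡-from-proj₁ (proj₂ (proj₂ (preimage μ t)))

-- Both sides also consist of the empty partition alone when n = 0.
corollary5 : (n s : ℕ) → 1 ≤ n → Overpartitions n s ↔ Schmidt2Overpartitions n s
corollary5 n s _ = overpartitions↔schmidt2 n s
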